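{- Let $q$ be a prime power and $n,k_1,k_2,t$ positive integers with $n\geq k_1+k_2+t+3$, $k_1\geq k_2\geq t+1$, and $k_2\geq 2t+1$. Then $g_4(k_1,k_2,n,t)g_2(k_2,n,t)>g_3(k_1,k_2,n,t)$, where $g_4(k,\ell,n,t)={\ell-t+1\brack 1}{n-t-1\brack k-t-1}-q{\ell-t+1\brack 2}{n-t-2\brack k-t-2}$, $g_2(\ell,n,t)={n-t\brack \ell-t}+q^{\ell+1-t}{t\brack 1}$, and $g_3(k,\ell,n,t)={n-t-1\brack k-t-1}\left(q^{\ell-t}{t+1\brack 1}{n-t-1\brack \ell-t}+{n-t-1\brack \ell-t-1}\right)$.
   Context: Gaussian binomial coefficient: ${a\brack b}=\prod_{0\leq i<b}\frac{q^{a-i}-1}{q^{b-i}-1}$ for positive integers $a,b$, with ${a\brack 0}=1$ and ${a\brack c}=0$ for negative $c$. -}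

module Defs where

open import Data.Nat as ℕ using (ℕ; zero; suc; _∸_; _^_)
open import Data.Integer as ℤ using (ℤ; +_; -[1+_])
open import Data.Rational using (ℚ; 0ℚ; 1ℚ; _*_; _/_)
open import Data.Nat.Primality using (Prime)
open import Data.Product using (Σ; _×_)
open import Relation.Binary.PropositionalEquality using (_≡_)

IsPrimePower : ℕ → Set
IsPrimePower q = Σ ℕ λ p → Σ ℕ λ e → Prime p × (1 ℕ.≤ e) × (q ≡ p ^ e)

-- one factor (q^x - 1)/(q^y - 1) as a rational; the "zero" branch never
-- occurs for q ≥ 2 and y ≥ 1 (it only makes the function total)
factor : ℕ → ℕ → ℕ → ℚ
factor q x y with q ^ y ∸ 1
... | zero  = 0ℚ
... | suc d = (+ (q ^ x ∸ 1)) / suc d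

gaussProd : ℕ → ℕ → ℕ → ℕ → ℚ
gaussProd q a b zero    = 1ℚ
gaussProd q a b (suc i) = gaussProd q a b i * factor q (a ∸ i) (b ∸ i)

-- Gaussian binomial [a brack c]_q; top index a ∈ ℕ, bottom index c ∈ ℤ,
-- equal to 0 for negative c and 1 for c = 0
gauss : ℕ → ℕ → ℤ → ℚ
gauss q a (+ b)    = gaussProd q a b b
gauss q a -[1+ _ ] = 0ℚ

module Submission where

-- Write A = [n-t-1, k₁-t-1], H = [t+1, 1] and L = k₂ - t.  Pascal's rule
-- [n-t, L] = [n-t-1, L-1] + q^L [n-t-1, L] turns g₃ into A [n-t-1, L-1] + A H q^L [n-t-1, L],
-- so g₃ < g₄ [n-t, L] ≤ g₄ g₂ as soon as A ≤ A H < g₄.  By absorption,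
-- [n-t-2, k₁-t-2] = A (q^(k₁-t-1) - 1) / (q^(n-t-1) - 1), so after clearing denominators
-- A H < g₄ is an inequality between integers built from powers of q.  It holds because
-- [L+1, 1] - [t+1, 1] ≥ q^L / (q-1), while n-t-1 ≥ (k₁-t-1) + L + 3 makes the subtracted
-- term of g₄, divided by A, smaller than q^L / (q-1).

open import Defs
open import Data.Nat as ℕ using (ℕ; zero; suc; _∸_; _^_; z≤n; s≤s)
import Data.Nat.Properties as ℕₚ
open import Data.Nat.Primality using (prime)
open import Data.Nat.Tactic.RingSolver using (solve-∀)
open import Data.Product using (_,_)
open import Relation.Binary.PropositionalEquality

module _ where
  open import Data.Nat using (_+_; _*_; _≤_; _<_)
  open ℕₚ
  open ≤-Reasoning

  isPrimePower⇒1< : ∀ {q} → IsPrimePower q → 1 < q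
  isPrimePower⇒1< (p , suc e , prime _ , _ , refl) =
    ≤-trans (ℕ.nonTrivial⇒n>1 p) (m≤m*n p (p ^ e) {{m^n≢0 p e {{ℕ.nonTrivial⇒nonZero p}}}})

  q*s≤w⇒s≤w∸1 : ∀ {q s w} → 1 < q → 1 ≤ s → q * s ≤ w → s ≤ w ∸ 1
  q*s≤w⇒s≤w∸1 {q} {s} {w} 1<q 1≤s qs≤w = m+n≤o⇒m≤o∸n s (begin
    s + 1     ≤⟨ +-monoʳ-≤ s (≤-trans 1≤s (≤-reflexive (sym (+-identityʳ s)))) ⟩
    2 * s     ≤⟨ *-monoˡ-≤ s 1<q ⟩
    q * s     ≤⟨ qs≤w ⟩
    w         ∎)

  -- A H < g₄ with denominators cleared, for x = q^(t+1), y = q^(k₂-t), z = q^(k₁-t-1), w = q^(n-t-1).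
  key-inequality : ∀ {q x y z w} → 1 < q → 1 ≤ y → 1 ≤ z → x ≤ y → q * q * q * y * z ≤ w →
    (x ∸ 1) * (q ^ 2 ∸ 1) * (w ∸ 1) + q * (q * y ∸ 1) * (y ∸ 1) * (z ∸ 1)
      < (q * y ∸ 1) * (q ^ 2 ∸ 1) * (w ∸ 1)
  key-inequality {q@(suc (suc _))} {x} {suc Y} {suc Z} {w}
                 1<q@(s≤s (s≤s z≤n)) (s≤s z≤n) (s≤s z≤n) x≤y qqqyz≤w = begin-strict
    X * Q * W + q * P * Y * Z  <⟨ +-monoʳ-< (X * Q * W) qPYZ<yQW ⟩
    X * Q * W + suc Y * Q * W  ≡⟨ distrib X (suc Y) Q W ⟩
    (X + suc Y) * Q * W        ≤⟨ *-monoˡ-≤ W (*-monoˡ-≤ Q X+y≤P) ⟩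
    P * Q * W                  ∎
    where
    X = x ∸ 1
    W = w ∸ 1
    P = q * suc Y ∸ 1
    Q = q ^ 2 ∸ 1
    S = q * q * suc Y * suc Z
    distrib : ∀ a b c d → a * c * d + b * c * d ≡ (a + b) * c * d
    distrib = solve-∀
    regroup : ∀ q y z → q * q * q * y * z ≡ q * (q * q * y * z)
    regroup = solve-∀
    regroup′ : ∀ q y Y Z → q * (q * y) * Y * Z ≡ q * q * y * (Y * Z)
    regroup′ = solve-∀
    regroup″ : ∀ q y z → q * q * y * (y * z) ≡ y * (q * q * y * z)
    regroup″ = solve-∀
    S≤W : S ≤ W
    S≤W = q*s≤w⇒s≤w∸1 1<q (s≤s z≤n) (subst (_≤ w) (regroup q (suc Y) (suc Z)) qqqyz≤w)
    X+y≤P : X + suc Y ≤ P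
    X+y≤P = begin
      X + suc Y           ≤⟨ +-monoˡ-≤ (suc Y) (∸-monoˡ-≤ 1 x≤y) ⟩
      Y + suc Y           ≡⟨ cong (λ m → Y + suc m) (sym (+-identityʳ Y)) ⟩
      2 * suc Y ∸ 1       ≤⟨ ∸-monoˡ-≤ 1 (*-monoˡ-≤ (suc Y) 1<q) ⟩
      P                   ∎
    YZ<yz : Y * Z < suc Y * suc Z
    YZ<yz = s≤s (≤-trans (*-monoʳ-≤ Y (n≤1+n Z)) (m≤n+m (Y * suc Z) Z))
    qPYZ<yQW : q * P * Y * Z < suc Y * Q * W
    qPYZ<yQW = begin-strict
      q * P * Y * Z                   ≤⟨ *-monoˡ-≤ Z (*-monoˡ-≤ Y (*-monoʳ-≤ q (m∸n≤m (q * suc Y) 1))) ⟩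
      q * (q * suc Y) * Y * Z         ≡⟨ regroup′ q (suc Y) Y Z ⟩
      q * q * suc Y * (Y * Z)         <⟨ *-monoʳ-< (q * q * suc Y) YZ<yz ⟩
      q * q * suc Y * (suc Y * suc Z) ≡⟨ regroup″ q (suc Y) (suc Z) ⟩
      suc Y * S                       ≤⟨ *-monoʳ-≤ (suc Y) S≤W ⟩
      suc Y * W                       ≤⟨ *-monoˡ-≤ W (m≤m*n (suc Y) Q) ⟩
      suc Y * Q * W                   ∎

  key-inequality-pow : ∀ {q i j k m} → 1 < q → i ≤ j → 3 + j + k ≤ m →
    (q ^ i ∸ 1) * (q ^ 2 ∸ 1) * (q ^ m ∸ 1) + q * (q ^ suc j ∸ 1) * (q ^ j ∸ 1) * (q ^ k ∸ 1)
      < (q ^ suc j ∸ 1) * (q ^ 2 ∸ 1) * (q ^ m ∸ 1)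
  key-inequality-pow {q@(suc (suc _))} {i} {j} {k} {m} 1<q@(s≤s (s≤s z≤n)) i≤j 3+j+k≤m =
    key-inequality 1<q (m^n>0 q j) (m^n>0 q k) (^-monoʳ-≤ q i≤j) (begin
      q * q * q * q ^ j * q ^ k
        ≡⟨ regroup q (q ^ j) (q ^ k) ⟩
      q ^ 3 * q ^ j * q ^ k
        ≡⟨ sym (trans (^-distribˡ-+-* q (3 + j) k) (cong (_* q ^ k) (^-distribˡ-+-* q 3 j))) ⟩
      q ^ (3 + j + k)
        ≤⟨ ^-monoʳ-≤ q 3+j+k≤m ⟩
      q ^ m                      ∎)
    where
    regroup : ∀ q a b → q * q * q * a * b ≡ q * (q * (q * 1)) * a * b
    regroup = solve-∀

  shift-bound : ∀ {n k₁ k₂ t} → t ≤ k₁ → k₁ + k₂ + t + 3 ≤ n → 3 + (k₂ ∸ t) + (k₁ ∸ t) ≤ n ∸ t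
  shift-bound {n} {k₁} {k₂} {t} t≤k₁ k₁+k₂+t+3≤n = m+n≤o⇒m≤o∸n (3 + (k₂ ∸ t) + (k₁ ∸ t)) (begin
    3 + (k₂ ∸ t) + (k₁ ∸ t) + t    ≡⟨ +-assoc (3 + (k₂ ∸ t)) (k₁ ∸ t) t ⟩
    3 + (k₂ ∸ t) + (k₁ ∸ t + t)    ≡⟨ cong (3 + (k₂ ∸ t) +_) (m∸n+n≡m t≤k₁) ⟩
    3 + (k₂ ∸ t) + k₁              ≤⟨ +-monoˡ-≤ k₁ (+-monoʳ-≤ 3 (m∸n≤m k₂ t)) ⟩
    3 + k₂ + k₁                    ≤⟨ m≤m+n (3 + k₂ + k₁) t ⟩
    3 + k₂ + k₁ + t                ≡⟨ reorder k₁ k₂ t ⟩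
    k₁ + k₂ + t + 3                ≤⟨ k₁+k₂+t+3≤n ⟩
    n                              ∎)
    where
    reorder : ∀ k₁ k₂ t → 3 + k₂ + k₁ + t ≡ k₁ + k₂ + t + 3
    reorder = solve-∀

open import Data.Nat.Coprimality using (1-coprimeTo)
import Data.Nat.Coprimality as Coprime
open import Data.Integer as ℤ using (ℤ; +_)
import Data.Integer.Properties as ℤₚ
open import Data.Rational
  using (ℚ; mkℚ; _*_; _+_; _-_; -_; _<_; _≤_; _/_; 0ℚ; 1ℚ; positive; nonNegative; toℚᵘ; *<*; *≤*)
import Data.Rational.Properties as ℚₚ
import Data.Rational.Unnormalised as ℚᵘ
import Data.Rational.Unnormalised.Properties as ℚᵘₚ
open import Data.Rational.Solver using (module +-*-Solver)
open +-*-Solver using (solve; _:+_; _:*_; _:-_; _:=_)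

fromℕ : ℕ → ℚ
fromℕ n = + n / 1

fromℕ≡mkℚ : ∀ n → fromℕ n ≡ mkℚ (+ n) 0 (Coprime.sym (1-coprimeTo n))
fromℕ≡mkℚ n = ℚₚ.normalize-coprime (Coprime.sym (1-coprimeTo n))

fromℕ-homo-* : ∀ m n → fromℕ (m ℕ.* n) ≡ fromℕ m * fromℕ n
fromℕ-homo-* m n = begin
  + (m ℕ.* n) / 1       ≡⟨ cong (_/ 1) (ℤₚ.pos-* m n) ⟩
  (+ m ℤ.* + n) / 1     ≡⟨ sym (cong₂ _*_ (fromℕ≡mkℚ m) (fromℕ≡mkℚ n)) ⟩
  fromℕ m * fromℕ n     ∎
  where open ≡-Reasoning

fromℕ-homo-+ : ∀ m n → fromℕ (m ℕ.+ n) ≡ fromℕ m + fromℕ n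
fromℕ-homo-+ m n = begin
  + (m ℕ.+ n) / 1
    ≡⟨ cong (_/ 1) (ℤₚ.pos-+ m n) ⟩
  (+ m ℤ.+ + n) / 1
    ≡⟨ cong (_/ 1) (sym (cong₂ ℤ._+_ (ℤₚ.*-identityʳ (+ m)) (ℤₚ.*-identityʳ (+ n)))) ⟩
  (+ m ℤ.* + 1 ℤ.+ + n ℤ.* + 1) / 1
    ≡⟨ sym (cong₂ _+_ (fromℕ≡mkℚ m) (fromℕ≡mkℚ n)) ⟩
  fromℕ m + fromℕ n                 ∎
  where open ≡-Reasoning

fromℕ-mono-< : ∀ {m n} → m ℕ.< n → fromℕ m < fromℕ n
fromℕ-mono-< {m} {n} m<n rewrite fromℕ≡mkℚ m | fromℕ≡mkℚ n =
  *<* (subst₂ ℤ._<_ (sym (ℤₚ.*-identityʳ (+ m))) (sym (ℤₚ.*-identityʳ (+ n))) (ℤ.+<+ m<n))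

fromℕ-mono-≤ : ∀ {m n} → m ℕ.≤ n → fromℕ m ≤ fromℕ n
fromℕ-mono-≤ {m} {n} m≤n rewrite fromℕ≡mkℚ m | fromℕ≡mkℚ n =
  *≤* (subst₂ ℤ._≤_ (sym (ℤₚ.*-identityʳ (+ m))) (sym (ℤₚ.*-identityʳ (+ n))) (ℤ.+≤+ m≤n))

n/d*d≡n : ∀ n d → (+ n / suc d) * fromℕ (suc d) ≡ fromℕ n
n/d*d≡n n d = ℚₚ.toℚᵘ-injective (begin
  toℚᵘ ((+ n / suc d) * fromℕ (suc d))
    ≈⟨ ℚₚ.toℚᵘ-homo-* (+ n / suc d) (fromℕ (suc d)) ⟩
  toℚᵘ (+ n / suc d) ℚᵘ.* toℚᵘ (fromℕ (suc d))
    ≈⟨ ℚᵘₚ.*-cong (ℚₚ.toℚᵘ-fromℚᵘ (ℚᵘ.mkℚᵘ (+ n) d)) (ℚₚ.toℚᵘ-fromℚᵘ (ℚᵘ.mkℚᵘ (+ suc d) 0)) ⟩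
  ℚᵘ.mkℚᵘ (+ n) d ℚᵘ.* ℚᵘ.mkℚᵘ (+ suc d) 0
    ≈⟨ ℚᵘ.*≡* (ℤₚ.*-assoc (+ n) (+ suc d) (+ 1)) ⟩
  ℚᵘ.mkℚᵘ (+ n) 0
    ≈⟨ ℚᵘₚ.≃-sym (ℚₚ.toℚᵘ-fromℚᵘ (ℚᵘ.mkℚᵘ (+ n) 0)) ⟩
  toℚᵘ (fromℕ n)                                   ∎)
  where open ℚᵘₚ.≃-Reasoning

[+m]-[+n]≡+[m∸n] : ∀ {m n} → n ℕ.≤ m → + m ℤ.- + n ≡ + (m ∸ n)
[+m]-[+n]≡+[m∸n] {m} {n} n≤m = trans (ℤₚ.m-n≡m⊖n m n) (ℤₚ.⊖-≥ n≤m)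

*-pos : ∀ {x y} → 0ℚ < x → 0ℚ < y → 0ℚ < x * y
*-pos {x} {y} 0<x 0<y = ℚₚ.positive⁻¹ (x * y) {{ℚₚ.pos*pos⇒pos x {{positive 0<x}} y {{positive 0<y}}}}

*-cancelʳ-≡-pos : ∀ {x y z} → 0ℚ < z → x * z ≡ y * z → x ≡ y
*-cancelʳ-≡-pos {z = z} 0<z xz≡yz = ℚₚ.≤-antisym
  (ℚₚ.*-cancelʳ-≤-pos z {{positive 0<z}} (ℚₚ.≤-reflexive xz≡yz))
  (ℚₚ.*-cancelʳ-≤-pos z {{positive 0<z}} (ℚₚ.≤-reflexive (sym xz≡yz)))

pow∸1 : ℕ → ℕ → ℚ
pow∸1 q m = fromℕ (q ^ m ∸ 1)

falling : ℕ → ℕ → ℕ → ℚ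
falling q a zero    = 1ℚ
falling q a (suc m) = falling q a m * pow∸1 q (a ∸ m)

falling-suc : ∀ q a m → falling q (suc a) (suc m) ≡ pow∸1 q (suc a) * falling q a m
falling-suc q a zero    = ℚₚ.*-comm 1ℚ (pow∸1 q (suc a))
falling-suc q a (suc m) = begin
  falling q (suc a) (suc m) * pow∸1 q (a ∸ m)    ≡⟨ cong (_* pow∸1 q (a ∸ m)) (falling-suc q a m) ⟩
  pow∸1 q (suc a) * falling q a m * pow∸1 q (a ∸ m) ≡⟨ ℚₚ.*-assoc (pow∸1 q (suc a)) _ _ ⟩
  pow∸1 q (suc a) * falling q a (suc m)            ∎
  where open ≡-Reasoning

module _ {q : ℕ} (1<q : 1 ℕ.< q) where

  private instance
    q≢0 : ℕ.NonZero q
    q≢0 = ℕ.>-nonZero (ℕₚ.<⇒≤ 1<q)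

  1≤q^m∸1 : ∀ {m} → 1 ℕ.≤ m → 1 ℕ.≤ q ^ m ∸ 1
  1≤q^m∸1 {suc m} _ = ℕₚ.∸-monoˡ-≤ 1 (ℕₚ.≤-trans 1<q (ℕₚ.m≤m*n q (q ^ m) {{ℕₚ.m^n≢0 q m}}))

  q^-pos : ∀ m → 0ℚ < fromℕ (q ^ m)
  q^-pos m = fromℕ-mono-< (ℕₚ.m^n>0 q m)

  pow∸1-pos : ∀ {m} → 1 ℕ.≤ m → 0ℚ < pow∸1 q m
  pow∸1-pos 1≤m = fromℕ-mono-< (1≤q^m∸1 1≤m)

  factor-*-pow∸1 : ∀ x {y} → 1 ℕ.≤ y → factor q x y * pow∸1 q y ≡ pow∸1 q x
  factor-*-pow∸1 x {y} 1≤y with q ^ y ∸ 1 | 1≤q^m∸1 1≤y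
  ... | suc d | _ = n/d*d≡n (q ^ x ∸ 1) d

  gaussProd-*-falling : ∀ a b m → m ℕ.≤ b → gaussProd q a b m * falling q b m ≡ falling q a m
  gaussProd-*-falling a b zero    _   = ℚₚ.*-identityˡ 1ℚ
  gaussProd-*-falling a b (suc m) m<b = begin
    gaussProd q a b m * f * (falling q b m * pow∸1 q (b ∸ m))
      ≡⟨ solve 4 (λ g f p u → (g :* f) :* (p :* u) := (g :* p) :* (f :* u))
                 refl (gaussProd q a b m) f (falling q b m) (pow∸1 q (b ∸ m)) ⟩
    gaussProd q a b m * falling q b m * (f * pow∸1 q (b ∸ m))
      ≡⟨ cong₂ _*_ (gaussProd-*-falling a b m (ℕₚ.<⇒≤ m<b)) (factor-*-pow∸1 (a ∸ m) (ℕₚ.m<n⇒0<n∸m m<b)) ⟩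
    falling q a m * pow∸1 q (a ∸ m) ∎
    where
    open ≡-Reasoning
    f = factor q (a ∸ m) (b ∸ m)

  gauss-*-falling : ∀ a b → gauss q a (+ b) * falling q b b ≡ falling q a b
  gauss-*-falling a b = gaussProd-*-falling a b b ℕₚ.≤-refl

  falling-pos : ∀ {a} m → m ℕ.≤ a → 0ℚ < falling q a m
  falling-pos zero    _   = ℚₚ.positive⁻¹ 1ℚ
  falling-pos (suc m) m<a = *-pos (falling-pos m (ℕₚ.<⇒≤ m<a)) (pow∸1-pos (ℕₚ.m<n⇒0<n∸m m<a))

  gauss-pos : ∀ {a b} → b ℕ.≤ a → 0ℚ < gauss q a (+ b)
  gauss-pos {a} {b} b≤a = ℚₚ.*-cancelʳ-<-nonNeg (falling q b b) {{ℚₚ.pos⇒nonNeg (falling q b b) {{positive fbb>0}}}}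
    (subst₂ _<_ (sym (ℚₚ.*-zeroˡ (falling q b b))) (sym (gauss-*-falling a b)) (falling-pos b b≤a))
    where
    fbb>0 : 0ℚ < falling q b b
    fbb>0 = falling-pos b ℕₚ.≤-refl

  gauss-absorption : ∀ a b → gauss q a (+ b) * pow∸1 q (suc a) ≡ gauss q (suc a) (+ suc b) * pow∸1 q (suc b)
  gauss-absorption a b = *-cancelʳ-≡-pos (falling-pos (suc b) ℕₚ.≤-refl) (begin
    G * ua * falling q (suc b) (suc b)
      ≡⟨ cong (G * ua *_) (falling-suc q b b) ⟩
    G * ua * (ub * falling q b b)
      ≡⟨ solve 4 (λ G ua ub F → G :* ua :* (ub :* F) := ua :* (G :* F) :* ub) refl G ua ub (falling q b b) ⟩
    ua * (G * falling q b b) * ub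
      ≡⟨ cong (λ x → ua * x * ub) (gauss-*-falling a b) ⟩
    ua * falling q a b * ub
      ≡⟨ cong (_* ub) (sym (falling-suc q a b)) ⟩
    falling q (suc a) (suc b) * ub
      ≡⟨ cong (_* ub) (sym (gauss-*-falling (suc a) (suc b))) ⟩
    G′ * falling q (suc b) (suc b) * ub
      ≡⟨ solve 3 (λ G′ F ub → G′ :* F :* ub := G′ :* ub :* F) refl G′ (falling q (suc b) (suc b)) ub ⟩
    G′ * ub * falling q (suc b) (suc b)   ∎)
    where
    open ≡-Reasoning
    G = gauss q a (+ b)
    G′ = gauss q (suc a) (+ suc b)
    ua = pow∸1 q (suc a)
    ub = pow∸1 q (suc b)

  pow∸1-+ : ∀ m k → pow∸1 q (m ℕ.+ k) ≡ pow∸1 q m + fromℕ (q ^ m) * pow∸1 q k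
  pow∸1-+ m k = begin
    fromℕ (q ^ (m ℕ.+ k) ∸ 1)
      ≡⟨ cong (λ x → fromℕ (x ∸ 1)) (ℕₚ.^-distribˡ-+-* q m k) ⟩
    fromℕ (q ^ m ℕ.* q ^ k ∸ 1)
      ≡⟨ cong fromℕ (split (ℕₚ.m^n>0 q m) (ℕₚ.m^n>0 q k)) ⟩
    fromℕ ((q ^ m ∸ 1) ℕ.+ q ^ m ℕ.* (q ^ k ∸ 1))
      ≡⟨ fromℕ-homo-+ (q ^ m ∸ 1) (q ^ m ℕ.* (q ^ k ∸ 1)) ⟩
    pow∸1 q m + fromℕ (q ^ m ℕ.* (q ^ k ∸ 1))
      ≡⟨ cong (λ x → pow∸1 q m + x) (fromℕ-homo-* (q ^ m) (q ^ k ∸ 1)) ⟩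
    pow∸1 q m + fromℕ (q ^ m) * pow∸1 q k          ∎
    where
    open ≡-Reasoning
    split′ : ∀ x y → y ℕ.+ x ℕ.* suc y ≡ x ℕ.+ suc x ℕ.* y
    split′ = solve-∀
    split : ∀ {x y} → 1 ℕ.≤ x → 1 ℕ.≤ y → x ℕ.* y ∸ 1 ≡ (x ∸ 1) ℕ.+ x ℕ.* (y ∸ 1)
    split {suc x} {suc y} _ _ = split′ x y

  gauss-pascal : ∀ {a b} → b ℕ.≤ a →
    gauss q (suc a) (+ suc b) ≡ gauss q a (+ b) + fromℕ (q ^ suc b) * gauss q a (+ suc b)
  gauss-pascal {a} {b} b≤a = *-cancelʳ-≡-pos (falling-pos (suc b) ℕₚ.≤-refl) (begin
    gauss q (suc a) (+ suc b) * falling q (suc b) (suc b)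
      ≡⟨ gauss-*-falling (suc a) (suc b) ⟩
    falling q (suc a) (suc b)
      ≡⟨ falling-suc q a b ⟩
    pow∸1 q (suc a) * falling q a b
      ≡⟨ cong (_* falling q a b) q^[1+a]-1 ⟩
    (ub + E * pow∸1 q (a ∸ b)) * falling q a b
      ≡⟨ solve 4 (λ ub E u F → (ub :+ E :* u) :* F := ub :* F :+ E :* (F :* u)) refl ub E (pow∸1 q (a ∸ b)) (falling q a b) ⟩
    ub * falling q a b + E * falling q a (suc b)
      ≡⟨ cong₂ (λ x y → ub * x + E * y) (sym (gauss-*-falling a b)) (sym (gauss-*-falling a (suc b))) ⟩
    ub * (G * Fb) + E * (G₁ * falling q (suc b) (suc b))
      ≡⟨ cong (λ x → ub * (G * Fb) + E * (G₁ * x)) (falling-suc q b b) ⟩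
    ub * (G * Fb) + E * (G₁ * (ub * Fb))
      ≡⟨ solve 5 (λ ub G Fb E G₁ → ub :* (G :* Fb) :+ E :* (G₁ :* (ub :* Fb)) := (G :+ E :* G₁) :* (ub :* Fb))
                 refl ub G Fb E G₁ ⟩
    (G + E * G₁) * (ub * Fb)
      ≡⟨ cong ((G + E * G₁) *_) (sym (falling-suc q b b)) ⟩
    (G + E * G₁) * falling q (suc b) (suc b)               ∎)
    where
    open ≡-Reasoning
    G = gauss q a (+ b)
    G₁ = gauss q a (+ suc b)
    E = fromℕ (q ^ suc b)
    ub = pow∸1 q (suc b)
    Fb = falling q b b
    q^[1+a]-1 : pow∸1 q (suc a) ≡ ub + E * pow∸1 q (a ∸ b)
    q^[1+a]-1 = trans (cong (λ m → pow∸1 q (suc m)) (sym (ℕₚ.m+[n∸m]≡n b≤a))) (pow∸1-+ (suc b) (a ∸ b))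

  gauss-1-*-pow∸1 : ∀ m → gauss q m (+ 1) * pow∸1 q 1 ≡ pow∸1 q m
  gauss-1-*-pow∸1 m = begin
    gauss q m (+ 1) * pow∸1 q 1            ≡⟨ cong (gauss q m (+ 1) *_) (sym (ℚₚ.*-identityˡ (pow∸1 q 1))) ⟩
    gauss q m (+ 1) * falling q 1 1        ≡⟨ gauss-*-falling m 1 ⟩
    1ℚ * pow∸1 q m                         ≡⟨ ℚₚ.*-identityˡ (pow∸1 q m) ⟩
    pow∸1 q m                              ∎
    where open ≡-Reasoning

  gauss-2-*-pow∸1 : ∀ m → gauss q m (+ 2) * (pow∸1 q 2 * pow∸1 q 1) ≡ pow∸1 q m * pow∸1 q (m ∸ 1)
  gauss-2-*-pow∸1 m = begin
    gauss q m (+ 2) * (pow∸1 q 2 * pow∸1 q 1)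
      ≡⟨ cong (λ x → gauss q m (+ 2) * (x * pow∸1 q 1)) (sym (ℚₚ.*-identityˡ (pow∸1 q 2))) ⟩
    gauss q m (+ 2) * falling q 2 2
      ≡⟨ gauss-*-falling m 2 ⟩
    1ℚ * pow∸1 q m * pow∸1 q (m ∸ 1)
      ≡⟨ cong (_* pow∸1 q (m ∸ 1)) (ℚₚ.*-identityˡ (pow∸1 q m)) ⟩
    pow∸1 q m * pow∸1 q (m ∸ 1)               ∎
    where open ≡-Reasoning

  1≤gauss-1 : ∀ {m} → 1 ℕ.≤ m → 1ℚ ≤ gauss q m (+ 1)
  1≤gauss-1 {m} 1≤m = ℚₚ.*-cancelʳ-≤-pos (pow∸1 q 1) {{positive (pow∸1-pos ℕₚ.≤-refl)}} (begin
    1ℚ * pow∸1 q 1                 ≡⟨ ℚₚ.*-identityˡ (pow∸1 q 1) ⟩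
    pow∸1 q 1                      ≤⟨ fromℕ-mono-≤ (ℕₚ.∸-monoˡ-≤ 1 (ℕₚ.^-monoʳ-≤ q 1≤m)) ⟩
    pow∸1 q m                      ≡⟨ sym (gauss-1-*-pow∸1 m) ⟩
    gauss q m (+ 1) * pow∸1 q 1    ∎)
    where open ℚₚ.≤-Reasoning

  gauss-key-inequality : ∀ {t a K L} → t ℕ.+ 1 ℕ.≤ L → 3 ℕ.+ L ℕ.+ suc K ℕ.≤ suc a →
    gauss q (suc a) (+ suc K) * gauss q (t ℕ.+ 1) (+ 1)
      < gauss q (suc L) (+ 1) * gauss q (suc a) (+ suc K) - fromℕ q * gauss q (suc L) (+ 2) * gauss q a (+ K)
  gauss-key-inequality {t} {a} {K} {L} t+1≤L bound =
    ℚₚ.*-cancelʳ-<-nonNeg Z {{ℚₚ.pos⇒nonNeg Z {{positive Z>0}}}}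
      (subst₂ _<_ (sym A*H*Z≡A*α) (sym g*Z≡A*[β-γ]) (ℚₚ.*-monoʳ-<-pos A {{positive A>0}} α<β-γ))
    where
    open ≡-Reasoning
    A = gauss q (suc a) (+ suc K)
    H = gauss q (t ℕ.+ 1) (+ 1)
    X₁ = gauss q (suc L) (+ 1)
    X₂ = gauss q (suc L) (+ 2)
    A′ = gauss q a (+ K)
    u₁ = pow∸1 q 1
    u₂ = pow∸1 q 2
    uₐ = pow∸1 q (suc a)
    uL = pow∸1 q (suc L)
    Z = u₁ * u₂ * uₐ
    α = pow∸1 q (t ℕ.+ 1) * u₂ * uₐ
    β = uL * u₂ * uₐ
    γ = fromℕ q * uL * pow∸1 q L * pow∸1 q (suc K)
    Z>0 : 0ℚ < Z
    Z>0 = *-pos (*-pos (pow∸1-pos {1} ℕₚ.≤-refl) (pow∸1-pos {2} (s≤s z≤n))) (pow∸1-pos {suc a} (s≤s z≤n))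
    A>0 : 0ℚ < A
    A>0 = gauss-pos (ℕₚ.≤-trans (ℕₚ.m≤n+m (suc K) (3 ℕ.+ L)) bound)
    A*H*Z≡A*α : A * H * Z ≡ A * α
    A*H*Z≡A*α = begin
      A * H * (u₁ * u₂ * uₐ)
        ≡⟨ solve 5 (λ A H u₁ u₂ uₐ → A :* H :* (u₁ :* u₂ :* uₐ) := A :* (H :* u₁ :* u₂ :* uₐ)) refl A H u₁ u₂ uₐ ⟩
      A * (H * u₁ * u₂ * uₐ)
        ≡⟨ cong (λ x → A * (x * u₂ * uₐ)) (gauss-1-*-pow∸1 (t ℕ.+ 1)) ⟩
      A * α                        ∎
    g*Z≡A*[β-γ] : (X₁ * A - fromℕ q * X₂ * A′) * Z ≡ A * (β - γ)
    g*Z≡A*[β-γ] = begin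
      (X₁ * A - fromℕ q * X₂ * A′) * (u₁ * u₂ * uₐ)
        ≡⟨ solve 8 (λ X₁ A Q X₂ A′ u₁ u₂ uₐ → (X₁ :* A :- Q :* X₂ :* A′) :* (u₁ :* u₂ :* uₐ)
                     := A :* (X₁ :* u₁) :* u₂ :* uₐ :- Q :* (X₂ :* (u₂ :* u₁)) :* (A′ :* uₐ))
             refl X₁ A (fromℕ q) X₂ A′ u₁ u₂ uₐ ⟩
      A * (X₁ * u₁) * u₂ * uₐ - fromℕ q * (X₂ * (u₂ * u₁)) * (A′ * uₐ)
        ≡⟨ cong₂ (λ x y → A * x * u₂ * uₐ - fromℕ q * y * (A′ * uₐ)) (gauss-1-*-pow∸1 (suc L)) (gauss-2-*-pow∸1 (suc L)) ⟩
      A * uL * u₂ * uₐ - fromℕ q * (uL * pow∸1 q L) * (A′ * uₐ)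
        ≡⟨ cong (λ x → A * uL * u₂ * uₐ - fromℕ q * (uL * pow∸1 q L) * x) (gauss-absorption a K) ⟩
      A * uL * u₂ * uₐ - fromℕ q * (uL * pow∸1 q L) * (A * pow∸1 q (suc K))
        ≡⟨ solve 7 (λ A uL u₂ uₐ Q u uK → A :* uL :* u₂ :* uₐ :- Q :* (uL :* u) :* (A :* uK)
                     := A :* (uL :* u₂ :* uₐ :- Q :* uL :* u :* uK))
             refl A uL u₂ uₐ (fromℕ q) (pow∸1 q L) (pow∸1 q (suc K)) ⟩
      A * (β - γ)  ∎
    fromℕ³ : ∀ x y z → fromℕ (x ℕ.* y ℕ.* z) ≡ fromℕ x * fromℕ y * fromℕ z
    fromℕ³ x y z = trans (fromℕ-homo-* (x ℕ.* y) z) (cong (_* fromℕ z) (fromℕ-homo-* x y))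
    fromℕ⁴ : ∀ w x y z → fromℕ (w ℕ.* x ℕ.* y ℕ.* z) ≡ fromℕ w * fromℕ x * fromℕ y * fromℕ z
    fromℕ⁴ w x y z = trans (fromℕ-homo-* (w ℕ.* x ℕ.* y) z) (cong (_* fromℕ z) (fromℕ³ w x y))
    nₜ = q ^ (t ℕ.+ 1) ∸ 1
    n₂ = q ^ 2 ∸ 1
    nₐ = q ^ suc a ∸ 1
    n_L = q ^ suc L ∸ 1
    α+γ<β : α + γ < β
    α+γ<β = subst₂ _<_
      (trans (fromℕ-homo-+ (nₜ ℕ.* n₂ ℕ.* nₐ) (q ℕ.* n_L ℕ.* (q ^ L ∸ 1) ℕ.* (q ^ suc K ∸ 1)))
             (cong₂ _+_ (fromℕ³ nₜ n₂ nₐ) (fromℕ⁴ q n_L (q ^ L ∸ 1) (q ^ suc K ∸ 1))))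
      (fromℕ³ n_L n₂ nₐ)
      (fromℕ-mono-< (key-inequality-pow 1<q t+1≤L bound))
    α<β-γ : α < β - γ
    α<β-γ = subst (_< β - γ) (solve 2 (λ α γ → α :+ γ :- γ := α) refl α γ) (ℚₚ.+-monoˡ-< (- γ) α+γ<β)

c[hm+b]<g[b+m+r] : ∀ {c h g b m r} → 0ℚ < c → 1ℚ ≤ h → c * h < g → 0ℚ ≤ b → 0ℚ < m → 0ℚ ≤ r →
  c * (h * m + b) < g * (b + m + r)
c[hm+b]<g[b+m+r] {c} {h} {g} {b} {m} {r} 0<c 1≤h ch<g 0≤b 0<m 0≤r = begin-strict
  c * (h * m + b)
    ≡⟨ solve 4 (λ c h m b → c :* (h :* m :+ b) := c :* h :* m :+ c :* b) refl c h m b ⟩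
  c * h * m + c * b
    <⟨ ℚₚ.+-monoˡ-< (c * b) (ℚₚ.*-monoˡ-<-pos m {{positive 0<m}} ch<g) ⟩
  g * m + c * b
    ≤⟨ ℚₚ.+-monoʳ-≤ (g * m) (ℚₚ.*-monoʳ-≤-nonNeg b {{nonNegative 0≤b}} c≤g) ⟩
  g * m + g * b
    ≡⟨ sym (ℚₚ.+-identityʳ (g * m + g * b)) ⟩
  g * m + g * b + 0ℚ
    ≤⟨ ℚₚ.+-monoʳ-≤ (g * m + g * b) 0≤gr ⟩
  g * m + g * b + g * r
    ≡⟨ solve 4 (λ g m b r → g :* m :+ g :* b :+ g :* r := g :* (b :+ m :+ r)) refl g m b r ⟩
  g * (b + m + r)          ∎
  where
  open ℚₚ.≤-Reasoning
  c≤g : c ≤ g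
  c≤g = ℚₚ.<⇒≤ (begin-strict
    c       ≡⟨ sym (ℚₚ.*-identityʳ c) ⟩
    c * 1ℚ  ≤⟨ ℚₚ.*-monoˡ-≤-nonNeg c {{nonNegative (ℚₚ.<⇒≤ 0<c)}} 1≤h ⟩
    c * h   <⟨ ch<g ⟩
    g       ∎)
  0≤gr : 0ℚ ≤ g * r
  0≤gr = ℚₚ.nonNegative⁻¹ (g * r)
    {{ℚₚ.nonNeg*nonNeg⇒nonNeg g {{nonNegative (ℚₚ.≤-trans (ℚₚ.<⇒≤ 0<c) c≤g)}} r {{nonNegative 0≤r}}}}

lemma5p2-shifted : ∀ {q} t N K L → 1 ℕ.< q → 1 ℕ.≤ t → suc t ℕ.≤ L → 2 ℕ.≤ K → 3 ℕ.+ L ℕ.+ K ℕ.≤ N →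
  gauss q (N ∸ 1) (+ K ℤ.- + 1)
    * (fromℕ (q ^ L) * gauss q (t ℕ.+ 1) (+ 1) * gauss q (N ∸ 1) (+ L) + gauss q (N ∸ 1) (+ L ℤ.- + 1))
  < (gauss q (suc L) (+ 1) * gauss q (N ∸ 1) (+ K ℤ.- + 1)
       - fromℕ q * gauss q (suc L) (+ 2) * gauss q (N ∸ 2) (+ K ℤ.- + 2))
    * (gauss q N (+ L) + fromℕ (q ^ suc L) * gauss q t (+ 1))
lemma5p2-shifted {q} t (suc (suc a)) (suc (suc K)) (suc ℓ)
                 1<q 1≤t (s≤s t≤ℓ) (s≤s (s≤s z≤n)) (s≤s (s≤s bound)) = begin-strict
  A * (E * H * M + B)
    ≡⟨ cong (λ x → A * (x + B)) (solve 3 (λ E H M → E :* H :* M := H :* (E :* M)) refl E H M) ⟩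
  A * (H * (E * M) + B)
    <⟨ c[hm+b]<g[b+m+r] A>0 1≤H (gauss-key-inequality 1<q t+1≤sℓ key-bound) 0≤B 0<EM 0≤R ⟩
  g₄ * (B + E * M + R)
    ≡⟨ cong (λ x → g₄ * (x + R)) (sym (gauss-pascal 1<q ℓ≤sa)) ⟩
  g₄ * (gauss q (suc (suc a)) (+ suc ℓ) + R) ∎
  where
  open ℚₚ.≤-Reasoning
  A = gauss q (suc a) (+ suc K)
  E = fromℕ (q ^ suc ℓ)
  H = gauss q (t ℕ.+ 1) (+ 1)
  M = gauss q (suc a) (+ suc ℓ)
  B = gauss q (suc a) (+ ℓ)
  R = fromℕ (q ^ suc (suc ℓ)) * gauss q t (+ 1)
  g₄ = gauss q (suc (suc ℓ)) (+ 1) * A - fromℕ q * gauss q (suc (suc ℓ)) (+ 2) * gauss q a (+ K)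
  ℓ+K+2≤a : ℓ ℕ.+ suc (suc K) ℕ.≤ a
  ℓ+K+2≤a = ℕₚ.m+n≤o⇒n≤o 2 bound
  ℓ≤a : ℓ ℕ.≤ a
  ℓ≤a = ℕₚ.m+n≤o⇒m≤o ℓ ℓ+K+2≤a
  ℓ≤sa : ℓ ℕ.≤ suc a
  ℓ≤sa = ℕₚ.m≤n⇒m≤1+n ℓ≤a
  K≤a : K ℕ.≤ a
  K≤a = ℕₚ.m+n≤o⇒n≤o 2 (ℕₚ.m+n≤o⇒n≤o ℓ ℓ+K+2≤a)
  t+1≤sℓ : t ℕ.+ 1 ℕ.≤ suc ℓ
  t+1≤sℓ = subst (ℕ._≤ suc ℓ) (ℕₚ.+-comm 1 t) (s≤s t≤ℓ)
  key-bound : 3 ℕ.+ suc ℓ ℕ.+ suc K ℕ.≤ suc a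
  key-bound = s≤s (subst (λ x → suc (suc x) ℕ.≤ a) (ℕₚ.+-suc ℓ (suc K)) bound)
  A>0 : 0ℚ < A
  A>0 = gauss-pos 1<q (s≤s K≤a)
  1≤H : 1ℚ ≤ H
  1≤H = 1≤gauss-1 1<q (ℕₚ.m≤n+m 1 t)
  0≤B : 0ℚ ≤ B
  0≤B = ℚₚ.<⇒≤ (gauss-pos 1<q ℓ≤sa)
  0<EM : 0ℚ < E * M
  0<EM = *-pos (q^-pos 1<q (suc ℓ)) (gauss-pos 1<q (s≤s ℓ≤a))
  0≤R : 0ℚ ≤ R
  0≤R = ℚₚ.<⇒≤ (*-pos (q^-pos 1<q (suc (suc ℓ))) (gauss-pos 1<q 1≤t))

lemma5p2 : (q n k₁ k₂ t : ℕ) → IsPrimePower q →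
    1 ℕ.≤ n → 1 ℕ.≤ k₁ → 1 ℕ.≤ k₂ → 1 ℕ.≤ t →
    k₁ ℕ.+ k₂ ℕ.+ t ℕ.+ 3 ℕ.≤ n → k₂ ℕ.≤ k₁ → t ℕ.+ 1 ℕ.≤ k₂ → 2 ℕ.* t ℕ.+ 1 ℕ.≤ k₂ →
    let
      qℚ : ℚ
      qℚ = + q Data.Rational./ 1
      pw : ℕ → ℚ
      pw m = + (q ^ m) Data.Rational./ 1
      g4 : ℚ
      g4 = gauss q (k₂ ∸ t ℕ.+ 1) (+ 1) * gauss q (n ∸ t ∸ 1) (+ k₁ ℤ.- + t ℤ.- + 1)
           - qℚ * gauss q (k₂ ∸ t ℕ.+ 1) (+ 2) * gauss q (n ∸ t ∸ 2) (+ k₁ ℤ.- + t ℤ.- + 2)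
      g2 : ℚ
      g2 = gauss q (n ∸ t) (+ k₂ ℤ.- + t) + pw (k₂ ℕ.+ 1 ∸ t) * gauss q t (+ 1)
      g3 : ℚ
      g3 = gauss q (n ∸ t ∸ 1) (+ k₁ ℤ.- + t ℤ.- + 1)
           * (pw (k₂ ∸ t) * gauss q (t ℕ.+ 1) (+ 1) * gauss q (n ∸ t ∸ 1) (+ k₂ ℤ.- + t)
              + gauss q (n ∸ t ∸ 1) (+ k₂ ℤ.- + t ℤ.- + 1))
    in g3 < g4 * g2
lemma5p2 q n k₁ k₂ t q-primePower _ _ _ 1≤t k₁+k₂+t+3≤n k₂≤k₁ t+1≤k₂ 2t+1≤k₂
  rewrite [+m]-[+n]≡+[m∸n] (ℕₚ.≤-trans (ℕₚ.m+n≤o⇒m≤o t t+1≤k₂) k₂≤k₁)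
        | [+m]-[+n]≡+[m∸n] (ℕₚ.m+n≤o⇒m≤o t t+1≤k₂)
        | ℕₚ.+-∸-comm 1 (ℕₚ.m+n≤o⇒m≤o t t+1≤k₂)
        | ℕₚ.+-comm (k₂ ∸ t) 1
  = lemma5p2-shifted t (n ∸ t) (k₁ ∸ t) (k₂ ∸ t) (isPrimePower⇒1< q-primePower) 1≤t t<k₂∸t 2≤k₁∸t
      (shift-bound t≤k₁ k₁+k₂+t+3≤n)
  where
  t≤k₁ : t ℕ.≤ k₁
  t≤k₁ = ℕₚ.≤-trans (ℕₚ.m+n≤o⇒m≤o t t+1≤k₂) k₂≤k₁
  t<k₂∸t : suc t ℕ.≤ k₂ ∸ t
  t<k₂∸t = ℕₚ.m+n≤o⇒m≤o∸n (suc t) (subst (ℕ._≤ k₂) (double t) 2t+1≤k₂)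
    where
    double : ∀ t → 2 ℕ.* t ℕ.+ 1 ≡ suc t ℕ.+ t
    double = solve-∀
  2≤k₁∸t : 2 ℕ.≤ k₁ ∸ t
  2≤k₁∸t = ℕₚ.≤-trans (s≤s 1≤t) (ℕₚ.≤-trans t<k₂∸t (ℕₚ.∸-monoˡ-≤ t k₂≤k₁))
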